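{- For non-negative integers $n$ and $\ell$, and real numbers $m$ and $r$, the $r$-Dowling polynomials satisfy $$D_{m,r}(n+\ell;x)=\sum_{j=0}^{\ell}\sum_{k=0}^nW_{m,r}(\ell,j)\binom{n}{k}(mj)^{n-k}D_{m,r}(k;x)\,x^j .$$ Consequently, the $r$-Dowling numbers satisfy $$D_{m,r}(n+\ell)=\sum_{j=0}^{\ell}\sum_{k=0}^nW_{m,r}(\ell,j)\binom{n}{k}(mj)^{n-k}D_{m,r}(k).$$
   Context: The $r$-Whitney numbers of the second kind $W_{m,r}(n,k)$ (for integers $n,k\ge 0$) are the coefficients in $(mt+r)^n=\sum_{k=0}^n m^kW_{m,r}(n,k)(t)_k$, where $(t)_k=t(t-1)\cdots(t-k+1)$; equivalently $W_{m,r}(0,0)=1$, $W_{m,r}(n,k)=0$ if $k<0$ or $k>n$, and $W_{m,r}(n,k)=W_{m,r}(n-1,k-1)+(mk+r)W_{m,r}(n-1,k)$ for $n\ge1$. The $r$-Dowling polynomials are $D_{m,r}(n;x)=\sum_{k=0}^nW_{m,r}(n,k)x^k$ and the $r$-Dowling numbers are $D_{m,r}(n)=D_{m,r}(n;1)$. The convention $0^0=1$ is used. -}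

module Defs where

open import Level using (Level)
open import Data.Nat using (ℕ; zero; suc; _∸_)
open import Data.Nat.Combinatorics using (_C_)
open import Algebra.Bundles using (CommutativeRing)

-- All notions are defined over an arbitrary commutative ring R
-- (the paper works over the reals).
module RDowling {c ℓ : Level} (R : CommutativeRing c ℓ) where
  open CommutativeRing R using (Carrier; _+_; _*_; 0#; 1#)

  ℕ→R : ℕ → Carrier
  ℕ→R zero    = 0#
  ℕ→R (suc n) = 1# + ℕ→R n

  -- powers, with a ^ 0 = 1 (so 0 ^ 0 = 1)
  pow : Carrier → ℕ → Carrier
  pow a zero    = 1#
  pow a (suc n) = a * pow a n

  sumTo : ℕ → (ℕ → Carrier) → Carrier
  sumTo zero    f = f 0
  sumTo (suc n) f = sumTo n f + f (suc n)

  W : Carrier → Carrier → ℕ → ℕ → Carrier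
  W m r zero    zero    = 1#
  W m r zero    (suc k) = 0#
  W m r (suc n) zero    = (m * ℕ→R 0 + r) * W m r n zero
  W m r (suc n) (suc k) = W m r n k + (m * ℕ→R (suc k) + r) * W m r n (suc k)

  D : Carrier → Carrier → ℕ → Carrier → Carrier
  D m r n x = sumTo n (λ k → W m r n k * pow x k)

  Dnum : Carrier → Carrier → ℕ → Carrier
  Dnum m r n = D m r n 1#

  binom : ℕ → ℕ → Carrier
  binom n k = ℕ→R (n C k)

module Submission where

-- Let U(n,j,·) be the row obtained by running the Whitney recurrence n times
-- from the unit row δ_j.  The recurrence is linear, and row l of W is
-- Σ_j W(l,j) δ_j, so  W(n+l,i) = Σ_j W(l,j) U(n,j,i)  (splitting lemma).
-- Row U(n,j,·) is supported on [j, n+j], and after shifting the index by j it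
-- satisfies the Whitney recurrence with r replaced by r + mj, i.e.
-- U(n,j,i+j) = W_{m,r+mj}(n,i).  Summing against powers of x therefore gives
--   D_{m,r}(n+l;x) = Σ_j W_{m,r}(l,j) x^j D_{m,r+mj}(n;x).
-- Finally the r-shift formula  W_{m,r+a}(n,i) = Σ_k C(n,k) a^{n-k} W_{m,r}(k,i),
-- proved by induction on n with Pascal's rule, lifts to the Dowling
-- polynomials and, with a = mj, turns the last display into the theorem.

open import Defs
open import Level using (Level)
open import Data.Nat using (ℕ; _+_; _∸_)
open import Data.Product using (_×_)
open import Algebra.Bundles using (CommutativeRing)
open CommutativeRing using (Carrier; _≈_; _*_)
open RDowling using (D; Dnum; W; sumTo; binom; pow; ℕ→R)
open import Data.Nat as ℕ using (zero; suc; _≤_; _<_; z≤n; s≤s)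
import Data.Nat.Properties as ℕₚ
open import Data.Nat.Combinatorics using (_C_; nCk+nC[k+1]≡[n+1]C[k+1])
open import Data.Nat.Combinatorics.Specification using (k>n⇒nCk≡0)
open import Data.Product using (_,_)
import Relation.Binary.PropositionalEquality as P

module DowlingIdentities {c ℓ : Level} (R : CommutativeRing c ℓ) where
  open CommutativeRing R hiding (zero)
    renaming (Carrier to A; _≈_ to _≃_; _*_ to _·_; _+_ to _⊕_)
  open import Relation.Binary.Reasoning.Setoid setoid
  open import Algebra.Solver.Ring.NaturalCoefficients.Default commutativeSemiring
    using (solve; _:=_; _:+_; _:*_)

  ι : ℕ → A
  ι = ℕ→R R

  pw : A → ℕ → A
  pw = pow R

  Σ : ℕ → (ℕ → A) → A
  Σ = sumTo R

  Wh : A → A → ℕ → ℕ → A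
  Wh = W R

  Σ-cong : ∀ N {f g : ℕ → A} → (∀ k → k ≤ N → f k ≃ g k) → Σ N f ≃ Σ N g
  Σ-cong zero    f≃g = f≃g 0 z≤n
  Σ-cong (suc N) f≃g =
    +-cong (Σ-cong N (λ k k≤N → f≃g k (ℕₚ.m≤n⇒m≤1+n k≤N))) (f≃g (suc N) ℕₚ.≤-refl)

  Σ-+ : ∀ N f g → Σ N (λ k → f k ⊕ g k) ≃ Σ N f ⊕ Σ N g
  Σ-+ zero    f g = refl
  Σ-+ (suc N) f g = trans (+-cong (Σ-+ N f g) refl)
    (solve 4 (λ a b c d → (a :+ b) :+ (c :+ d) := (a :+ c) :+ (b :+ d)) refl _ _ _ _)

  Σ-*ˡ : ∀ N a f → a · Σ N f ≃ Σ N (λ k → a · f k)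
  Σ-*ˡ zero    a f = refl
  Σ-*ˡ (suc N) a f = trans (distribˡ a _ _) (+-cong (Σ-*ˡ N a f) refl)

  Σ-*ʳ : ∀ N a f → Σ N f · a ≃ Σ N (λ k → f k · a)
  Σ-*ʳ zero    a f = refl
  Σ-*ʳ (suc N) a f = trans (distribʳ a _ _) (+-cong (Σ-*ʳ N a f) refl)

  Σ-swap : ∀ N M (f : ℕ → ℕ → A) →
           Σ N (λ i → Σ M (λ j → f i j)) ≃ Σ M (λ j → Σ N (λ i → f i j))
  Σ-swap zero    M f = refl
  Σ-swap (suc N) M f = trans (+-cong (Σ-swap N M f) refl) (sym (Σ-+ M _ _))

  Σ-head : ∀ N f → Σ (suc N) f ≃ f 0 ⊕ Σ N (λ k → f (suc k))
  Σ-head zero    f = refl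
  Σ-head (suc N) f = trans (+-cong (Σ-head N f) refl) (+-assoc _ _ _)

  Σ-vanish : ∀ N f → (∀ k → k ≤ N → f k ≃ 0#) → Σ N f ≃ 0#
  Σ-vanish zero    f f≃0 = f≃0 0 z≤n
  Σ-vanish (suc N) f f≃0 =
    trans (+-cong (Σ-vanish N f (λ k k≤N → f≃0 k (ℕₚ.m≤n⇒m≤1+n k≤N)))
                  (f≃0 (suc N) ℕₚ.≤-refl))
          (+-identityʳ 0#)

  Σ-extend : ∀ d N f → (∀ k → N < k → f k ≃ 0#) → Σ (d ℕ.+ N) f ≃ Σ N f
  Σ-extend zero    N f tail≃0 = refl
  Σ-extend (suc d) N f tail≃0 =
    trans (+-cong (Σ-extend d N f tail≃0) (tail≃0 _ (s≤s (ℕₚ.m≤n+m N d))))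
          (+-identityʳ _)

  Σ-drop : ∀ j N f → (∀ k → k < j → f k ≃ 0#) →
           Σ (N ℕ.+ j) f ≃ Σ N (λ t → f (t ℕ.+ j))
  Σ-drop zero    N f _ = begin
    Σ (N ℕ.+ 0) f             ≡⟨ P.cong (λ z → Σ z f) (ℕₚ.+-identityʳ N) ⟩
    Σ N f                     ≈⟨ Σ-cong N (λ t _ → reflexive (P.cong f (P.sym (ℕₚ.+-identityʳ t)))) ⟩
    Σ N (λ t → f (t ℕ.+ 0))   ∎
  Σ-drop (suc j) N f head≃0 = begin
    Σ (N ℕ.+ suc j) f                      ≡⟨ P.cong (λ z → Σ z f) (ℕₚ.+-suc N j) ⟩
    Σ (suc (N ℕ.+ j)) f                    ≈⟨ Σ-head (N ℕ.+ j) f ⟩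
    f 0 ⊕ Σ (N ℕ.+ j) (λ k → f (suc k))    ≈⟨ +-cong (head≃0 0 (s≤s z≤n))
                                                (Σ-drop j N (λ k → f (suc k))
                                                  (λ k k<j → head≃0 (suc k) (s≤s k<j))) ⟩
    0# ⊕ Σ N (λ t → f (suc (t ℕ.+ j)))     ≈⟨ +-identityˡ _ ⟩
    Σ N (λ t → f (suc (t ℕ.+ j)))          ≈⟨ Σ-cong N (λ t _ → reflexive (P.cong f (P.sym (ℕₚ.+-suc t j)))) ⟩
    Σ N (λ t → f (t ℕ.+ suc j))            ∎

  ι-+ : ∀ a b → ι (a ℕ.+ b) ≃ ι a ⊕ ι b
  ι-+ zero    b = sym (+-identityˡ _)
  ι-+ (suc a) b = trans (+-cong refl (ι-+ a b)) (sym (+-assoc _ _ _))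

  pw-+ : ∀ x t j → pw x (t ℕ.+ j) ≃ pw x t · pw x j
  pw-+ x zero    j = sym (*-identityˡ _)
  pw-+ x (suc t) j = trans (*-cong refl (pw-+ x t j)) (sym (*-assoc _ _ _))

  pw-1 : ∀ j → pw 1# j ≃ 1#
  pw-1 zero    = refl
  pw-1 (suc j) = trans (*-identityˡ _) (pw-1 j)

  T : A → ℕ → ℕ → A
  T a n k = binom R n k · pw a (n ℕ.∸ k)

  T-pascal : ∀ a n k (g : A) →
             T a (suc n) (suc k) · g ≃ T a n k · g ⊕ (binom R n (suc k) · pw a (n ℕ.∸ k)) · g
  T-pascal a n k g = begin
    (ι (suc n C suc k) · pw a (n ℕ.∸ k)) · g
      ≡⟨ P.cong (λ z → (ι z · pw a (n ℕ.∸ k)) · g) (P.sym (nCk+nC[k+1]≡[n+1]C[k+1] n k)) ⟩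
    (ι (n C k ℕ.+ n C suc k) · pw a (n ℕ.∸ k)) · g
      ≈⟨ *-cong (*-cong (ι-+ (n C k) (n C suc k)) refl) refl ⟩
    ((ι (n C k) ⊕ ι (n C suc k)) · pw a (n ℕ.∸ k)) · g
      ≈⟨ solve 4 (λ u v p q → ((u :+ v) :* p) :* q := (u :* p) :* q :+ (v :* p) :* q) refl _ _ _ _ ⟩
    T a n k · g ⊕ (ι (n C suc k) · pw a (n ℕ.∸ k)) · g ∎

  T-raise : ∀ a n k (g : A) → k ≤ n → (binom R n k · pw a (suc n ℕ.∸ k)) · g ≃ a · (T a n k · g)
  T-raise a n k g k≤n =
    trans (reflexive (P.cong (λ z → (binom R n k · pw a z) · g) (ℕₚ.+-∸-assoc 1 k≤n)))
          (solve 4 (λ u a p q → (u :* (a :* p)) :* q := a :* ((u :* p) :* q)) refl _ _ _ _)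

  T-top : ∀ a n e (g : A) → (binom R n (suc n) · pw a e) · g ≃ 0#
  T-top a n e g =
    trans (*-cong (*-cong (reflexive (P.cong ι (k>n⇒nCk≡0 (ℕₚ.n<1+n n)))) refl) refl)
          (trans (*-cong (zeroˡ _) refl) (zeroˡ _))

  pascal : ∀ n a (g : ℕ → A) →
           Σ (suc n) (λ k → T a (suc n) k · g k)
             ≃ a · Σ n (λ k → T a n k · g k) ⊕ Σ n (λ k → T a n k · g (suc k))
  pascal n a g = begin
    Σ (suc n) (λ k → T a (suc n) k · g k)                   ≈⟨ Σ-head n _ ⟩
    first ⊕ Σ n (λ k → T a (suc n) (suc k) · g (suc k))    ≈⟨ +-cong refl (Σ-cong n (λ k _ → T-pascal a n k (g (suc k)))) ⟩
    first ⊕ Σ n (λ k → T a n k · g (suc k) ⊕ upper k)      ≈⟨ +-cong refl (Σ-+ n _ _) ⟩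
    first ⊕ (shifted ⊕ Σ n upper)                          ≈⟨ solve 3 (λ x y z → x :+ (y :+ z) := (x :+ z) :+ y) refl first shifted (Σ n upper) ⟩
    (first ⊕ Σ n upper) ⊕ shifted                          ≈⟨ +-cong (sym (Σ-head n _)) refl ⟩
    Σ (suc n) raised ⊕ shifted                             ≈⟨ +-cong (trans (+-cong refl (T-top a n (n ℕ.∸ n) (g (suc n)))) (+-identityʳ _)) refl ⟩
    Σ n raised ⊕ shifted                                   ≈⟨ +-cong (Σ-cong n (λ k k≤n → T-raise a n k (g k) k≤n)) refl ⟩
    Σ n (λ k → a · (T a n k · g k)) ⊕ shifted              ≈⟨ +-cong (sym (Σ-*ˡ n _ _)) refl ⟩
    a · Σ n (λ k → T a n k · g k) ⊕ shifted                ∎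
    where
    first shifted : A
    first   = (binom R n 0 · pw a (suc n)) · g 0
    shifted = Σ n (λ k → T a n k · g (suc k))
    upper raised : ℕ → A
    upper k  = (binom R n (suc k) · pw a (n ℕ.∸ k)) · g (suc k)
    raised k = (binom R n k · pw a (suc n ℕ.∸ k)) · g k

  δ : ℕ → ℕ → A
  δ zero    zero    = 1#
  δ zero    (suc i) = 0#
  δ (suc j) zero    = 0#
  δ (suc j) (suc i) = δ j i

  δ-shift : ∀ j i → δ j (i ℕ.+ j) P.≡ δ 0 i
  δ-shift zero    i = P.cong (δ 0) (ℕₚ.+-identityʳ i)
  δ-shift (suc j) i = P.trans (P.cong (δ (suc j)) (ℕₚ.+-suc i j)) (δ-shift j i)

  δ-below : ∀ j i → i < j → δ j i ≃ 0#
  δ-below (suc j) zero    _         = refl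
  δ-below (suc j) (suc i) (s≤s i<j) = δ-below j i i<j

  δ-above : ∀ j i → j < i → δ j i ≃ 0#
  δ-above zero    (suc i) _         = refl
  δ-above (suc j) (suc i) (s≤s j<i) = δ-above j i j<i

  δ-expand : ∀ N f i → (∀ k → N < k → f k ≃ 0#) → Σ N (λ j → f j · δ j i) ≃ f i
  δ-expand zero f zero    _      = *-identityʳ _
  δ-expand zero f (suc i) tail≃0 = trans (zeroʳ _) (sym (tail≃0 (suc i) (s≤s z≤n)))
  δ-expand (suc N) f i tail≃0 = trans (Σ-head N _) (expand-head i)
    where
    expand-head : ∀ i → f 0 · δ 0 i ⊕ Σ N (λ k → f (suc k) · δ (suc k) i) ≃ f i
    expand-head zero    = trans (+-cong (*-identityʳ _) (Σ-vanish N _ (λ k _ → zeroʳ _)))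
                                (+-identityʳ _)
    expand-head (suc i) = trans (+-cong (zeroʳ _)
                                 (δ-expand N (λ k → f (suc k)) i (λ k N<k → tail≃0 (suc k) (s≤s N<k))))
                                (+-identityˡ _)

  step-vanish : ∀ {a b} → a ≃ 0# → b ≃ 0# → ∀ c → a ⊕ c · b ≃ 0#
  step-vanish a≃0 b≃0 c = trans (+-cong a≃0 (trans (*-cong refl b≃0) (zeroʳ c))) (+-identityʳ _)

  -- From here on m is fixed and r varies (the r-shift relates different r).
  module _ (m : A) where

    coeff : A → ℕ → A
    coeff r q = m · ι q ⊕ r

    coeff-split : ∀ r i j → coeff r (i ℕ.+ j) ≃ coeff (r ⊕ m · ι j) i
    coeff-split r i j = trans (+-cong (*-cong refl (ι-+ i j)) refl)
      (solve 4 (λ m u v r → m :* (u :+ v) :+ r := m :* u :+ (r :+ m :* v)) refl m (ι i) (ι j) r)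

    W-row₀ : ∀ r i → Wh m r 0 i P.≡ δ 0 i
    W-row₀ r zero    = P.refl
    W-row₀ r (suc i) = P.refl

    W-above : ∀ r n i → n < i → Wh m r n i ≃ 0#
    W-above r zero    (suc i) _         = refl
    W-above r (suc n) (suc i) (s≤s n<i) =
      step-vanish (W-above r n i n<i) (W-above r n (suc i) (ℕₚ.m<n⇒m<1+n n<i)) _

    -- r-shift formula:  W_{m,r+a}(n,i) = Σ_k C(n,k) a^{n-k} W_{m,r}(k,i).
    -- Induction on n: both sides obey the recurrence with coefficient m·i + r + a,
    -- the right-hand side by Pascal's rule.
    module _ (r a : A) where

      binomialColumn : ℕ → ℕ → A
      binomialColumn n i = Σ n (λ k → T a n k · Wh m r k i)

      W-shift : ∀ n i → Wh m (r ⊕ a) n i ≃ binomialColumn n i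
      W-shift zero i = begin
        Wh m (r ⊕ a) 0 i           ≡⟨ P.trans (W-row₀ (r ⊕ a) i) (P.sym (W-row₀ r i)) ⟩
        Wh m r 0 i                 ≈⟨ sym (*-identityˡ _) ⟩
        1# · Wh m r 0 i            ≈⟨ *-cong (sym (trans (*-identityʳ _) (+-identityʳ _))) refl ⟩
        T a 0 0 · Wh m r 0 i       ∎
      W-shift (suc n) zero = begin
        coeff (r ⊕ a) 0 · Wh m (r ⊕ a) n 0
          ≈⟨ *-cong (solve 4 (λ m z r a → m :* z :+ (r :+ a) := a :+ (m :* z :+ r)) refl m (ι 0) r a)
                    (W-shift n 0) ⟩
        (a ⊕ coeff r 0) · S n 0
          ≈⟨ trans (distribʳ _ _ _) (+-cong refl (Σ-*ˡ n _ _)) ⟩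
        a · S n 0 ⊕ Σ n (λ k → coeff r 0 · (T a n k · Wh m r k 0))
          ≈⟨ +-cong refl (Σ-cong n (λ k _ → solve 3 (λ c t w → c :* (t :* w) := t :* (c :* w)) refl _ _ _)) ⟩
        a · S n 0 ⊕ Σ n (λ k → T a n k · Wh m r (suc k) 0)
          ≈⟨ sym (pascal n a (λ k → Wh m r k 0)) ⟩
        S (suc n) 0 ∎
        where
        S : ℕ → ℕ → A
        S = binomialColumn
      W-shift (suc n) (suc p) = begin
        Wh m (r ⊕ a) n p ⊕ coeff (r ⊕ a) (suc p) · Wh m (r ⊕ a) n (suc p)
          ≈⟨ +-cong (W-shift n p) (*-cong refl (W-shift n (suc p))) ⟩
        S n p ⊕ coeff (r ⊕ a) (suc p) · S n (suc p)
          ≈⟨ solve 6 (λ m q r a x y → x :+ (m :* q :+ (r :+ a)) :* y := a :* y :+ (x :+ (m :* q :+ r) :* y))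
                   refl m (ι (suc p)) r a (S n p) (S n (suc p)) ⟩
        a · S n (suc p) ⊕ (S n p ⊕ coeff r (suc p) · S n (suc p))
          ≈⟨ +-cong refl (trans (+-cong refl (Σ-*ˡ n _ _)) (sym (Σ-+ n _ _))) ⟩
        a · S n (suc p) ⊕ Σ n (λ k → T a n k · Wh m r k p ⊕ coeff r (suc p) · (T a n k · Wh m r k (suc p)))
          ≈⟨ +-cong refl (Σ-cong n (λ k _ →
               solve 4 (λ t x c y → t :* x :+ c :* (t :* y) := t :* (x :+ c :* y)) refl _ _ _ _)) ⟩
        a · S n (suc p) ⊕ Σ n (λ k → T a n k · Wh m r (suc k) (suc p))
          ≈⟨ sym (pascal n a (λ k → Wh m r k (suc p))) ⟩
        S (suc n) (suc p) ∎
        where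
        S : ℕ → ℕ → A
        S = binomialColumn

    D-extend : ∀ r N k x → k ≤ N → Σ N (λ t → Wh m r k t · pw x t) ≃ D R m r k x
    D-extend r N k x k≤N =
      trans (reflexive (P.cong (λ z → Σ z (λ t → Wh m r k t · pw x t)) (P.sym (ℕₚ.m∸n+n≡m k≤N))))
            (Σ-extend (N ℕ.∸ k) k _ (λ t k<t → trans (*-cong (W-above r k t k<t) refl) (zeroˡ _)))

    D-shift : ∀ r a n x → D R m (r ⊕ a) n x ≃ Σ n (λ k → T a n k · D R m r k x)
    D-shift r a n x = begin
      Σ n (λ t → Wh m (r ⊕ a) n t · pw x t)
        ≈⟨ Σ-cong n (λ t _ → trans (*-cong (W-shift r a n t) refl) (Σ-*ʳ n _ _)) ⟩
      Σ n (λ t → Σ n (λ k → (T a n k · Wh m r k t) · pw x t))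
        ≈⟨ Σ-swap n n _ ⟩
      Σ n (λ k → Σ n (λ t → (T a n k · Wh m r k t) · pw x t))
        ≈⟨ Σ-cong n (λ k _ → trans (Σ-cong n (λ t _ → *-assoc _ _ _)) (sym (Σ-*ˡ n _ _))) ⟩
      Σ n (λ k → T a n k · Σ n (λ t → Wh m r k t · pw x t))
        ≈⟨ Σ-cong n (λ k k≤n → *-cong refl (D-extend r n k x k≤n)) ⟩
      Σ n (λ k → T a n k · D R m r k x) ∎

    module _ (r : A) where

      U : ℕ → ℕ → ℕ → A
      U zero    j i       = δ j i
      U (suc n) j zero    = coeff r 0 · U n j zero
      U (suc n) j (suc i) = U n j i ⊕ coeff r (suc i) · U n j (suc i)

      U-below : ∀ n j i → i < j → U n j i ≃ 0#
      U-below zero    j i       i<j = δ-below j i i<j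
      U-below (suc n) j zero    0<j = trans (*-cong refl (U-below n j 0 0<j)) (zeroʳ _)
      U-below (suc n) j (suc i) i<j =
        step-vanish (U-below n j i (ℕₚ.<-trans (ℕₚ.n<1+n i) i<j)) (U-below n j (suc i) i<j) _

      U-above : ∀ n j i → n ℕ.+ j < i → U n j i ≃ 0#
      U-above zero    j i       j<i         = δ-above j i j<i
      U-above (suc n) j (suc i) (s≤s n+j<i) =
        step-vanish (U-above n j i n+j<i) (U-above n j (suc i) (ℕₚ.m<n⇒m<1+n n+j<i)) _

      -- Splitting lemma: by linearity of the recurrence,
      --   W(n+l,i) = Σ_j W(l,j) U(n,j,i).
      W-split : ∀ n l i → Wh m r (n ℕ.+ l) i ≃ Σ l (λ j → Wh m r l j · U n j i)
      W-split zero    l i       = sym (δ-expand l (Wh m r l) i (W-above r l))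
      W-split (suc n) l zero    = begin
        coeff r 0 · Wh m r (n ℕ.+ l) 0                ≈⟨ *-cong refl (W-split n l 0) ⟩
        coeff r 0 · Σ l (λ j → Wh m r l j · U n j 0)  ≈⟨ Σ-*ˡ l _ _ ⟩
        Σ l (λ j → coeff r 0 · (Wh m r l j · U n j 0)) ≈⟨ Σ-cong l (λ j _ →
                                                          solve 3 (λ a b c → a :* (b :* c) := b :* (a :* c)) refl _ _ _) ⟩
        Σ l (λ j → Wh m r l j · U (suc n) j 0)       ∎
      W-split (suc n) l (suc p) = begin
        Wh m r (n ℕ.+ l) p ⊕ coeff r (suc p) · Wh m r (n ℕ.+ l) (suc p)
          ≈⟨ +-cong (W-split n l p) (trans (*-cong refl (W-split n l (suc p))) (Σ-*ˡ l _ _)) ⟩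
        Σ l (λ j → Wh m r l j · U n j p) ⊕ Σ l (λ j → coeff r (suc p) · (Wh m r l j · U n j (suc p)))
          ≈⟨ sym (Σ-+ l _ _) ⟩
        Σ l (λ j → Wh m r l j · U n j p ⊕ coeff r (suc p) · (Wh m r l j · U n j (suc p)))
          ≈⟨ Σ-cong l (λ j _ → solve 4 (λ w a b c → w :* a :+ c :* (w :* b) := w :* (a :+ c :* b))
                                       refl (Wh m r l j) (U n j p) (U n j (suc p)) (coeff r (suc p))) ⟩
        Σ l (λ j → Wh m r l j · U (suc n) j (suc p)) ∎

      U-as-W : ∀ n j i → U n j (i ℕ.+ j) ≃ Wh m (r ⊕ m · ι j) n i
      U-as-W zero j i = reflexive (P.trans (δ-shift j i) (P.sym (W-row₀ (r ⊕ m · ι j) i)))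
      U-as-W (suc n) zero zero =
        *-cong (coeff-split r 0 0) (U-as-W n 0 0)
      U-as-W (suc n) (suc j) zero = begin
        U n (suc j) j ⊕ coeff r (suc j) · U n (suc j) (suc j)
          ≈⟨ +-cong (U-below n (suc j) j (ℕₚ.n<1+n j)) (*-cong (coeff-split r 0 (suc j)) (U-as-W n (suc j) 0)) ⟩
        0# ⊕ coeff (r ⊕ m · ι (suc j)) 0 · Wh m (r ⊕ m · ι (suc j)) n 0
          ≈⟨ +-identityˡ _ ⟩
        coeff (r ⊕ m · ι (suc j)) 0 · Wh m (r ⊕ m · ι (suc j)) n 0 ∎
      U-as-W (suc n) j (suc p) =
        +-cong (U-as-W n j p) (*-cong (coeff-split r (suc p) j) (U-as-W n j (suc p)))

      U-poly : ∀ n l j x → j ≤ l → Σ (n ℕ.+ l) (λ i → U n j i · pw x i) ≃ pw x j · D R m (r ⊕ m · ι j) n x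
      U-poly n l j x j≤l = begin
        Σ (n ℕ.+ l) F                   ≡⟨ P.cong (λ z → Σ z F) range ⟩
        Σ ((l ℕ.∸ j) ℕ.+ (n ℕ.+ j)) F   ≈⟨ Σ-extend (l ℕ.∸ j) (n ℕ.+ j) F
                                            (λ i n+j<i → trans (*-cong (U-above n j i n+j<i) refl) (zeroˡ _)) ⟩
        Σ (n ℕ.+ j) F                   ≈⟨ Σ-drop j n F (λ i i<j → trans (*-cong (U-below n j i i<j) refl) (zeroˡ _)) ⟩
        Σ n (λ t → F (t ℕ.+ j))         ≈⟨ Σ-cong n (λ t _ → trans (*-cong (U-as-W n j t) (pw-+ x t j))
                                            (solve 3 (λ w p q → w :* (p :* q) := q :* (w :* p)) refl _ _ _)) ⟩
        Σ n (λ t → pw x j · (Wh m (r ⊕ m · ι j) n t · pw x t)) ≈⟨ sym (Σ-*ˡ n _ _) ⟩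
        pw x j · D R m (r ⊕ m · ι j) n x ∎
        where
        F : ℕ → A
        F i = U n j i · pw x i
        range : n ℕ.+ l P.≡ (l ℕ.∸ j) ℕ.+ (n ℕ.+ j)
        range = P.trans (ℕₚ.+-comm n l) (P.trans (P.cong (ℕ._+ n) (P.sym (ℕₚ.m∸n+n≡m j≤l)))
                  (P.trans (ℕₚ.+-assoc (l ℕ.∸ j) j n) (P.cong ((l ℕ.∸ j) ℕ.+_) (ℕₚ.+-comm j n))))

      D-split : ∀ n l x → D R m r (n ℕ.+ l) x ≃ Σ l (λ j → Wh m r l j · (pw x j · D R m (r ⊕ m · ι j) n x))
      D-split n l x = begin
        Σ (n ℕ.+ l) (λ i → Wh m r (n ℕ.+ l) i · pw x i)
          ≈⟨ Σ-cong (n ℕ.+ l) (λ i _ → trans (*-cong (W-split n l i) refl) (Σ-*ʳ l _ _)) ⟩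
        Σ (n ℕ.+ l) (λ i → Σ l (λ j → (Wh m r l j · U n j i) · pw x i))
          ≈⟨ Σ-swap (n ℕ.+ l) l _ ⟩
        Σ l (λ j → Σ (n ℕ.+ l) (λ i → (Wh m r l j · U n j i) · pw x i))
          ≈⟨ Σ-cong l (λ j j≤l → trans (Σ-cong (n ℕ.+ l) (λ i _ → *-assoc _ _ _))
                                 (trans (sym (Σ-*ˡ (n ℕ.+ l) _ _)) (*-cong refl (U-poly n l j x j≤l)))) ⟩
        Σ l (λ j → Wh m r l j · (pw x j · D R m (r ⊕ m · ι j) n x)) ∎

      D-convolution : ∀ n l x → D R m r (n ℕ.+ l) x ≃
        Σ l (λ j → Σ n (λ k → (((Wh m r l j · binom R n k) · pw (m · ι j) (n ℕ.∸ k)) · D R m r k x) · pw x j))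
      D-convolution n l x = trans (D-split n l x) (Σ-cong l (λ j _ → begin
        Wh m r l j · (pw x j · D R m (r ⊕ m · ι j) n x)
          ≈⟨ *-cong refl (*-cong refl (D-shift r (m · ι j) n x)) ⟩
        Wh m r l j · (pw x j · Σ n (λ k → T (m · ι j) n k · D R m r k x))
          ≈⟨ trans (*-cong refl (Σ-*ˡ n _ _)) (Σ-*ˡ n _ _) ⟩
        Σ n (λ k → Wh m r l j · (pw x j · ((binom R n k · pw (m · ι j) (n ℕ.∸ k)) · D R m r k x)))
          ≈⟨ Σ-cong n (λ k _ → solve 5 (λ w y b p d → w :* (y :* ((b :* p) :* d)) := (((w :* b) :* p) :* d) :* y)
                                       refl _ _ _ _ _) ⟩
        Σ n (λ k → (((Wh m r l j · binom R n k) · pw (m · ι j) (n ℕ.∸ k)) · D R m r k x) · pw x j) ∎))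

      Dnum-convolution : ∀ n l → Dnum R m r (n ℕ.+ l) ≃
        Σ l (λ j → Σ n (λ k → ((Wh m r l j · binom R n k) · pw (m · ι j) (n ℕ.∸ k)) · Dnum R m r k))
      Dnum-convolution n l = trans (D-convolution n l 1#)
        (Σ-cong l (λ j _ → Σ-cong n (λ k _ → trans (*-cong refl (pw-1 j)) (*-identityʳ _))))

theorem2 : {c ℓ : Level} (R : CommutativeRing c ℓ) (n l : ℕ) (m r : Carrier R) →
    ((x : Carrier R) →
       _≈_ R (D R m r (n + l) x)
         (sumTo R l (λ j → sumTo R n (λ k →
            _*_ R (_*_ R (_*_ R (_*_ R (W R m r l j) (binom R n k))
                                (pow R (_*_ R m (ℕ→R R j)) (n ∸ k)))
                         (D R m r k x))
                  (pow R x j)))))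
    × _≈_ R (Dnum R m r (n + l))
        (sumTo R l (λ j → sumTo R n (λ k →
           _*_ R (_*_ R (_*_ R (W R m r l j) (binom R n k))
                        (pow R (_*_ R m (ℕ→R R j)) (n ∸ k)))
                 (Dnum R m r k))))
theorem2 R n l m r = D-convolution m r n l , Dnum-convolution m r n l
  where open DowlingIdentities R
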